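{- For every integer $n\ge3$, there exists a set $R$ of triplets with $|\mathcal{L}(R)|=n$ such that (1) $R$ is incompatible, (2) every proper subset of $R$ is compatible, and (3) $|R|=n-1$.
   Context: A rooted phylogenetic tree is a tree with a distinguished vertex called the root, in which no non-root vertex has degree two, and whose leaves are in bijection with a label set. It is binary if the root has degree two and every other internal vertex has degree three. A triplet is a rooted binary tree with exactly three leaves; $ab|c$ denotes the triplet on $\{a,b,c\}$ in which the path between the leaves $a$ and $b$ does not contain the root. $\mathcal{L}(R)$ is the union of the label sets of the triplets in $R$. For a rooted tree $T$ and $L\subseteq\mathcal{L}(T)$, the restriction $T|L$ is obtained from the minimal subtree $T'$ of $T$ connecting the leaves labeled by $L$ by taking as root the vertex of $T'$ closest to the root of $T$ and suppressing every non-root degree-two vertex. A rooted tree $T$ displays a rooted tree $T'$ if $T'$ can be obtained from $T|\mathcal{L}(T')$ by contracting edges. A set of rooted trees is compatible if some rooted phylogenetic tree displays all of them, and incompatible otherwise. -}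

module Defs where

open import Data.Nat using (ℕ; _<_; _≟_; _≤_)
open import Data.List using (List; []; _∷_; _++_; length)
open import Data.List.Membership.Propositional using (_∈_)
open import Data.List.Membership.DecPropositional _≟_ using (_∈?_)
open import Data.List.Relation.Unary.All using (All)
open import Data.List.Relation.Unary.Any using (Any)
open import Data.List.Relation.Unary.Unique.Propositional using (Unique)
open import Data.List.Relation.Binary.Permutation.Propositional using (_↭_)
open import Data.List.Relation.Binary.Pointwise using (Pointwise)
open import Data.List.Relation.Binary.Subset.Propositional using (_⊆_)
open import Data.Maybe using (Maybe; just; nothing)
open import Data.Product using (Σ; _×_; _,_; ∃; ∃-syntax)
open import Relation.Binary.PropositionalEquality using (_≡_; _≢_)
open import Relation.Binary.Construct.Closure.ReflexiveTransitive using (Star)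
open import Relation.Nullary using (¬_; yes; no)
open import Function.Bundles using (_⇔_)

-- A vertex is either a leaf carrying a label, or an internal vertex
-- with a list of children (the order of children is irrelevant; trees
-- are compared up to isomorphism `_≅_` below).

data Tree : Set where
  leaf : ℕ → Tree
  node : List Tree → Tree

mutual
  leaves : Tree → List ℕ
  leaves (leaf x)  = x ∷ []
  leaves (node ts) = leavesF ts

  leavesF : List Tree → List ℕ
  leavesF []       = []
  leavesF (t ∷ ts) = leaves t ++ leavesF ts

-- Every non-root internal vertex has at least two children
-- (i.e. degree ≥ 3, so no non-root vertex of degree two).
mutual
  data NonRootOK : Tree → Set where
    leafOK : ∀ {x} → NonRootOK (leaf x)
    nodeOK : ∀ {ts} → 2 ≤ length ts → AllOK ts → NonRootOK (node ts)

  data AllOK : List Tree → Set where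
    []  : AllOK []
    _∷_ : ∀ {t ts} → NonRootOK t → AllOK ts → AllOK (t ∷ ts)

data RootOK : Tree → Set where
  rootLeaf : ∀ {x} → RootOK (leaf x)
  rootNode : ∀ {ts} → 1 ≤ length ts → AllOK ts → RootOK (node ts)

-- A rooted phylogenetic tree: shape conditions above, and the leaf
-- labelling is a bijection onto its label set (labels pairwise distinct).
record Phylo (T : Tree) : Set where
  field
    shape    : RootOK T
    distinct : Unique (leaves T)

-- Restriction T|L.  `prune L t` returns the minimal subtree connecting
-- the leaves of t labelled in L, rooted at its vertex closest to the
-- root, with all degree-two non-root vertices suppressed (nothing if
-- no leaf of t is labelled in L).

mutual
  prune : List ℕ → Tree → Maybe Tree
  prune L (leaf x) with x ∈? L
  ... | yes _ = just (leaf x)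
  ... | no  _ = nothing
  prune L (node ts) with pruneF L ts
  ... | []          = nothing
  ... | (t ∷ [])    = just t
  ... | (t ∷ u ∷ us) = just (node (t ∷ u ∷ us))

  pruneF : List ℕ → List Tree → List Tree
  pruneF L []       = []
  pruneF L (t ∷ ts) with prune L t
  ... | just t' = t' ∷ pruneF L ts
  ... | nothing = pruneF L ts

_∣_≡restr_ : Tree → List ℕ → Tree → Set
T ∣ L ≡restr T' = prune L T ≡ just T'

data _≅_ : Tree → Tree → Set where
  leaf≅ : ∀ {x} → leaf x ≅ leaf x
  node≅ : ∀ {ts us vs} → ts ↭ us → Pointwise _≅_ us vs → node ts ≅ node vs

data ContractStep : Tree → Tree → Set where
  here   : ∀ xs us ys →
           ContractStep (node (xs ++ node us ∷ ys)) (node (xs ++ us ++ ys))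
  inside : ∀ xs {t t'} ys → ContractStep t t' →
           ContractStep (node (xs ++ t ∷ ys)) (node (xs ++ t' ∷ ys))

Contracts : Tree → Tree → Set
Contracts = Star ContractStep

-- Triplets.  The triplet ab|c is represented by the triple (a , b , c)
-- in the canonical form a < b (so ab|c = ba|c has a unique code),
-- with c distinct from a and b.

Triplet : Set
Triplet = ℕ × ℕ × ℕ

IsTriplet : Triplet → Set
IsTriplet (a , b , c) = (a < b) × (c ≢ a) × (c ≢ b)

tripletTree : Triplet → Tree
tripletTree (a , b , c) = node (node (leaf a ∷ leaf b ∷ []) ∷ leaf c ∷ [])

labelsOf : Triplet → List ℕ
labelsOf (a , b , c) = a ∷ b ∷ c ∷ []

Displays : Tree → Triplet → Set
Displays T t =
  labelsOf t ⊆ leaves T ×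
  ∃[ T' ] (T ∣ labelsOf t ≡restr T' ×
           ∃[ T'' ] (Contracts T' T'' × T'' ≅ tripletTree t))

Compatible : List Triplet → Set
Compatible R = ∃[ T ] (Phylo T × All (Displays T) R)

InLabels : ℕ → List Triplet → Set
InLabels x R = Any (λ t → x ∈ labelsOf t) R

LabelCount : List Triplet → ℕ → Set
LabelCount R n =
  ∃[ Ls ] (Unique Ls × length Ls ≡ n × (∀ x → (x ∈ Ls ⇔ InLabels x R)))

TripletSet : List Triplet → Set
TripletSet R = All IsTriplet R × Unique R

ProperSubset : List Triplet → List Triplet → Set
ProperSubset S R = S ⊆ R × ¬ (R ⊆ S)

-- With n = p + 3 labels 0, …, p+2, take R = {01|(p+2)} ∪ {x(x+1)|0 : 1 ≤ x ≤ p+1}.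
-- A tree displays ab|c exactly when one of its clusters contains a and b but not c (conversely,
-- the restriction to {a, b, c} is then a cherry on a, b beside the leaf c), and two clusters of a
-- tree with distinct labels that share a label are nested.  If T displayed R, the cluster C
-- witnessing 01|(p+2) would contain 1; the cluster witnessing x(x+1)|0 shares x with C and misses
-- 0 ∈ C, so it lies inside C and x+1 ∈ C.  Inductively p+2 ∈ C, a contradiction.  Without
-- 01|(p+2), R is displayed by (0, (1, (2, …, (p+1, p+2)))); without x(x+1)|0 it is displayed
-- by ((0, (1, …, x)), (x+1, …, p+2)), both halves being caterpillars.

module Submission where

open import Defs
open import Data.Empty using (⊥-elim)
open import Data.List using (List; []; _∷_; _++_; length; filter; map; iterate)
open import Data.List.Properties using (filter-++; ++-identityʳ; ++-assoc; length-map; length-iterate)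
open import Data.List.Membership.Propositional using (_∈_; _∉_; find; lose)
open import Data.List.Membership.Propositional.Properties
  using (∈-++⁺ˡ; ∈-++⁺ʳ; ∈-++⁻; ∈-filter⁺; ∈-filter⁻; ∈-∃++; ∈-insert; ∈-map⁺; ∈-map⁻)
open import Data.List.Relation.Binary.Disjoint.Propositional using (Disjoint)
open import Data.List.Relation.Binary.Permutation.Propositional using (↭-refl; ↭-sym; swap)
open import Data.List.Relation.Binary.Permutation.Propositional.Properties using (∈-resp-↭)
open import Data.List.Relation.Binary.Pointwise using ([]; _∷_)
open import Data.List.Relation.Binary.Subset.Propositional using (_⊆_)
open import Data.List.Relation.Binary.Subset.Propositional.Properties
  using (All-resp-⊇; ++⁺ʳ; xs⊆ys++xs; xs⊆x∷xs)
open import Data.List.Relation.Unary.All as All using (All; []; _∷_)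
open import Data.List.Relation.Unary.All.Properties using (¬All⇒Any¬)
open import Data.List.Relation.Unary.Any using (Any; here; there)
open import Data.List.Relation.Unary.Unique.Propositional using (Unique; []; _∷_)
open import Data.List.Relation.Unary.Unique.Propositional.Properties
  using (filter⁺) renaming (map⁺ to Unique-map⁺)
open import Data.Maybe using (just; nothing; maybe′)
open import Data.Nat using (ℕ; zero; suc; _+_; _∸_; _≤_; _<_; _≟_; z≤n; s≤s; z<s)
open import Data.Nat.Properties
  using (≤-refl; ≤-trans; ≤-pred; <⇒≤; <⇒≢; <⇒≱; ≤∧≢⇒<; <-cmp; n≤1+n; n<1+n; m≤n⇒m≤1+n; m≤m+n; m<m+n;
         +-suc; +-identityʳ; m≤n⇒∃[o]m+o≡n)
open import Data.Product using (_×_; _,_; ∃-syntax; proj₁; proj₂; map₁; map₂)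
open import Data.Product.Properties using (≡-dec)
open import Data.Sum using (_⊎_; inj₁; inj₂)
open import Function using (_∘_)
open import Function.Bundles using (mk⇔)
open import Relation.Binary.Construct.Closure.ReflexiveTransitive using (ε; _◅_)
open import Relation.Binary.Definitions using (tri<; tri≈; tri>)
open import Relation.Binary.PropositionalEquality
  using (_≡_; _≢_; refl; sym; trans; cong; cong₂; subst; module ≡-Reasoning)
open import Relation.Nullary using (¬_; yes; no; contradiction)

open import Data.List.Membership.DecPropositional _≟_ using (_∈?_)
open import Data.List.Membership.DecPropositional (≡-dec _≟_ (≡-dec _≟_ _≟_))
  using () renaming (_∈?_ to _∈ₜ?_)

module _ {A : Set} where

  Unique-++⁻ˡ : ∀ (xs : List A) {ys} → Unique (xs ++ ys) → Unique xs
  Unique-++⁻ˡ []       _          = []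
  Unique-++⁻ˡ (x ∷ xs) (x∉ ∷ uniq) = All.tabulate (λ y∈xs → All.lookup x∉ (∈-++⁺ˡ y∈xs)) ∷ Unique-++⁻ˡ xs uniq

  Unique-++⁻ʳ : ∀ (xs : List A) {ys} → Unique (xs ++ ys) → Unique ys
  Unique-++⁻ʳ []       uniq       = uniq
  Unique-++⁻ʳ (_ ∷ xs) (_ ∷ uniq) = Unique-++⁻ʳ xs uniq

  Unique-++⇒Disjoint : ∀ (xs : List A) {ys} → Unique (xs ++ ys) → Disjoint xs ys
  Unique-++⇒Disjoint (_ ∷ xs) (x∉ ∷ _)    (here refl , y∈ys)  = All.lookup x∉ (∈-++⁺ʳ xs y∈ys) refl
  Unique-++⇒Disjoint (_ ∷ xs) (_ ∷ uniq) (there y∈xs , y∈ys) = Unique-++⇒Disjoint xs uniq (y∈xs , y∈ys)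

  Unique-++-middle⁻ : ∀ (xs : List A) {ys zs} → Unique (xs ++ ys ++ zs) →
                      Unique ys × Unique (xs ++ zs) × Disjoint ys (xs ++ zs)
  Unique-++-middle⁻ []           {ys} uniq =
    Unique-++⁻ˡ ys uniq , Unique-++⁻ʳ ys uniq , Unique-++⇒Disjoint ys uniq
  Unique-++-middle⁻ (x ∷ xs) {ys} {zs} (x∉ ∷ uniq) with Unique-++-middle⁻ xs uniq
  ... | uniq-ys , uniq-rest , ys#rest = uniq-ys , x∉rest ∷ uniq-rest , ys#x∷rest
    where
    x∉rest : All (x ≢_) (xs ++ zs)
    x∉rest = All-resp-⊇ (++⁺ʳ xs (xs⊆ys++xs zs ys)) x∉
    ys#x∷rest : Disjoint ys (x ∷ xs ++ zs)
    ys#x∷rest (x∈ys , here refl) = All.lookup x∉ (∈-++⁺ʳ xs (∈-++⁺ˡ x∈ys)) refl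
    ys#x∷rest (y∈ys , there y∈)  = ys#rest (y∈ys , y∈)

leavesF-++ : ∀ ts us → leavesF (ts ++ us) ≡ leavesF ts ++ leavesF us
leavesF-++ []       us = refl
leavesF-++ (t ∷ ts) us = trans (cong (leaves t ++_) (leavesF-++ ts us)) (sym (++-assoc (leaves t) _ _))

∈-leavesF⁺ : ∀ {x t ts} → t ∈ ts → x ∈ leaves t → x ∈ leavesF ts
∈-leavesF⁺ {ts = t ∷ ts} (here refl) x∈t = ∈-++⁺ˡ x∈t
∈-leavesF⁺ {ts = t ∷ ts} (there t∈) x∈t = ∈-++⁺ʳ (leaves t) (∈-leavesF⁺ t∈ x∈t)

∈-leavesF⁻ : ∀ {x} ts → x ∈ leavesF ts → ∃[ t ] (t ∈ ts × x ∈ leaves t)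
∈-leavesF⁻ (t ∷ ts) x∈ with ∈-++⁻ (leaves t) x∈
... | inj₁ x∈t = t , here refl , x∈t
... | inj₂ x∈ts with ∈-leavesF⁻ ts x∈ts
...   | u , u∈ts , x∈u = u , there u∈ts , x∈u

leavesF-mono : ∀ {ts us} → ts ⊆ us → leavesF ts ⊆ leavesF us
leavesF-mono {ts} ts⊆us x∈ with ∈-leavesF⁻ ts x∈
... | t , t∈ts , x∈t = ∈-leavesF⁺ (ts⊆us t∈ts) x∈t

data _⊑_ : Tree → Tree → Set where
  ⊑-refl  : ∀ {t} → t ⊑ t
  ⊑-child : ∀ {s t ts} → t ∈ ts → s ⊑ t → s ⊑ node ts

leaves-⊑ : ∀ {s t} → s ⊑ t → leaves s ⊆ leaves t
leaves-⊑ ⊑-refl             x∈s = x∈s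
leaves-⊑ (⊑-child t∈ s⊑t) x∈s = ∈-leavesF⁺ t∈ (leaves-⊑ s⊑t x∈s)

child-Unique : ∀ {t} ts → t ∈ ts → Unique (leavesF ts) → Unique (leaves t)
child-Unique (u ∷ ts) (here refl) uniq = Unique-++⁻ˡ (leaves u) uniq
child-Unique (u ∷ ts) (there t∈)  uniq = child-Unique ts t∈ (Unique-++⁻ʳ (leaves u) uniq)

shared-leaf⇒same-child : ∀ {t u x} ts → t ∈ ts → u ∈ ts → Unique (leavesF ts) →
                         x ∈ leaves t → x ∈ leaves u → t ≡ u
shared-leaf⇒same-child (v ∷ ts) (here refl) (here refl) _ _ _ = refl
shared-leaf⇒same-child (v ∷ ts) (here refl) (there u∈) uniq x∈t x∈u =
  contradiction (x∈t , ∈-leavesF⁺ u∈ x∈u) (Unique-++⇒Disjoint (leaves v) uniq)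
shared-leaf⇒same-child (v ∷ ts) (there t∈) (here refl) uniq x∈t x∈u =
  contradiction (x∈u , ∈-leavesF⁺ t∈ x∈t) (Unique-++⇒Disjoint (leaves v) uniq)
shared-leaf⇒same-child (v ∷ ts) (there t∈) (there u∈) uniq x∈t x∈u =
  shared-leaf⇒same-child ts t∈ u∈ (Unique-++⁻ʳ (leaves v) uniq) x∈t x∈u

clusters-nested : ∀ {T u v x} → Unique (leaves T) → u ⊑ T → v ⊑ T → x ∈ leaves u → x ∈ leaves v →
                  leaves u ⊆ leaves v ⊎ leaves v ⊆ leaves u
clusters-nested uniq ⊑-refl v⊑T _ _ = inj₂ (leaves-⊑ v⊑T)
clusters-nested uniq u⊑T@(⊑-child _ _) ⊑-refl _ _ = inj₁ (leaves-⊑ u⊑T)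
clusters-nested {node ts} uniq (⊑-child t∈ u⊑t) (⊑-child t′∈ v⊑t′) x∈u x∈v
  with shared-leaf⇒same-child ts t∈ t′∈ uniq (leaves-⊑ u⊑t x∈u) (leaves-⊑ v⊑t′ x∈v)
... | refl = clusters-nested (child-Unique ts t∈ uniq) u⊑t v⊑t′ x∈u x∈v

data Branching : Tree → Set where
  leaf : ∀ {x} → Branching (leaf x)
  node : ∀ {t u us} → All Branching (t ∷ u ∷ us) → Branching (node (t ∷ u ∷ us))

children-Branching : ∀ {ts} → Branching (node ts) → All Branching ts
children-Branching (node bs) = bs

leaves-nonempty : ∀ {t} → Branching t → ∃[ x ] x ∈ leaves t
leaves-nonempty (leaf {x}) = x , here refl
leaves-nonempty (node (b ∷ _)) with leaves-nonempty b
... | x , x∈ = x , ∈-++⁺ˡ x∈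

mutual
  leaves-prune : ∀ L t → maybe′ leaves [] (prune L t) ≡ filter (_∈? L) (leaves t)
  leaves-prune L (leaf x) with x ∈? L
  ... | yes _ = refl
  ... | no  _ = refl
  leaves-prune L (node ts) with pruneF L ts | leavesF-pruneF L ts
  ... | []          | e = e
  ... | t ∷ []      | e = trans (sym (++-identityʳ (leaves t))) e
  ... | _ ∷ _ ∷ _   | e = e

  leavesF-pruneF : ∀ L ts → leavesF (pruneF L ts) ≡ filter (_∈? L) (leavesF ts)
  leavesF-pruneF L []       = refl
  leavesF-pruneF L (t ∷ ts) with prune L t | leaves-prune L t
  ... | just _  | e = trans (cong₂ _++_ e (leavesF-pruneF L ts)) (sym (filter-++ (_∈? L) (leaves t) (leavesF ts)))
  ... | nothing | e = trans (cong₂ _++_ e (leavesF-pruneF L ts)) (sym (filter-++ (_∈? L) (leaves t) (leavesF ts)))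

prune≡just⇒leaves : ∀ L t {t′} → prune L t ≡ just t′ → leaves t′ ≡ filter (_∈? L) (leaves t)
prune≡just⇒leaves L t e = trans (cong (maybe′ leaves []) (sym e)) (leaves-prune L t)

∈-prune⁺ : ∀ L t {t′ x} → prune L t ≡ just t′ → x ∈ leaves t → x ∈ L → x ∈ leaves t′
∈-prune⁺ L t e x∈t x∈L = subst (_ ∈_) (sym (prune≡just⇒leaves L t e)) (∈-filter⁺ (_∈? L) x∈t x∈L)

∈-prune⁻ : ∀ L t {t′ x} → prune L t ≡ just t′ → x ∈ leaves t′ → x ∈ leaves t × x ∈ L
∈-prune⁻ L t e x∈t′ = ∈-filter⁻ (_∈? L) (subst (_ ∈_) (prune≡just⇒leaves L t e) x∈t′)

prune-defined : ∀ L t {x} → x ∈ L → x ∈ leaves t → ∃[ t′ ] prune L t ≡ just t′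
prune-defined L t x∈L x∈t with prune L t | leaves-prune L t
... | just t′ | _ = t′ , refl
... | nothing | e with subst (_ ∈_) (sym e) (∈-filter⁺ (_∈? L) x∈t x∈L)
...   | ()

mutual
  prune-Branching : ∀ L t {t′} → prune L t ≡ just t′ → Branching t′
  prune-Branching L (leaf x) e with x ∈? L
  prune-Branching L (leaf x) refl | yes _ = leaf
  prune-Branching L (leaf x) ()   | no  _
  prune-Branching L (node ts) e with pruneF L ts | pruneF-Branching L ts
  prune-Branching L (node ts) ()   | []        | _
  prune-Branching L (node ts) refl | _ ∷ []    | b ∷ [] = b
  prune-Branching L (node ts) refl | _ ∷ _ ∷ _ | bs = node bs

  pruneF-Branching : ∀ L ts → All Branching (pruneF L ts)
  pruneF-Branching L []       = []
  pruneF-Branching L (t ∷ ts) with prune L t in e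
  ... | just _  = prune-Branching L t e ∷ pruneF-Branching L ts
  ... | nothing = pruneF-Branching L ts

∈-pruneF⁺ : ∀ L ts {t t′} → t ∈ ts → prune L t ≡ just t′ → t′ ∈ pruneF L ts
∈-pruneF⁺ L (u ∷ ts) (here refl) e with prune L u
∈-pruneF⁺ L (u ∷ ts) (here refl) refl | just _ = here refl
∈-pruneF⁺ L (u ∷ ts) (there t∈) e with prune L u
... | just _  = there (∈-pruneF⁺ L ts t∈ e)
... | nothing = ∈-pruneF⁺ L ts t∈ e

prune-⊑ : ∀ L {s t s′} → s ⊑ t → prune L s ≡ just s′ → ∃[ t′ ] (prune L t ≡ just t′ × s′ ⊑ t′)
prune-⊑ L ⊑-refl e = _ , e , ⊑-refl
prune-⊑ L (⊑-child {ts = ts} u∈ s⊑u) e with prune-⊑ L s⊑u e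
... | u′ , e′ , s′⊑u′ with pruneF L ts | ∈-pruneF⁺ L ts u∈ e′
...   | _ ∷ []    | here refl = u′ , refl , s′⊑u′
...   | _ ∷ _ ∷ _ | u′∈       = _ , refl , ⊑-child u′∈ s′⊑u′

⊑-node : ∀ {s ts} → Any (s ⊑_) ts → s ⊑ node ts
⊑-node s⊑child with find s⊑child
... | _ , u∈ , s⊑u = ⊑-child u∈ s⊑u

mutual
  prune-⊑⁻ : ∀ L t {t′ s′} → prune L t ≡ just t′ → s′ ⊑ t′ → ∃[ s ] (s ⊑ t × prune L s ≡ just s′)
  prune-⊑⁻ L t e ⊑-refl = t , ⊑-refl , e
  prune-⊑⁻ L (leaf x) e (⊑-child _ _) with x ∈? L
  prune-⊑⁻ L (leaf x) () (⊑-child _ _) | yes _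
  prune-⊑⁻ L (leaf x) () (⊑-child _ _) | no  _
  prune-⊑⁻ L (node ts) e (⊑-child u′∈ s′⊑u′) with pruneF L ts in eF
  prune-⊑⁻ L (node ts) () (⊑-child _ _) | []
  prune-⊑⁻ L (node ts) refl s′⊑t′@(⊑-child _ _) | _ ∷ [] =
    map₂ (map₁ ⊑-node) (prune-⊑⁻-child L ts (subst (_ ∈_) (sym eF) (here refl)) s′⊑t′)
  prune-⊑⁻ L (node ts) refl (⊑-child u′∈ s′⊑u′) | _ ∷ _ ∷ _ =
    map₂ (map₁ ⊑-node) (prune-⊑⁻-child L ts (subst (_ ∈_) (sym eF) u′∈) s′⊑u′)

  prune-⊑⁻-child : ∀ L ts {u′ s′} → u′ ∈ pruneF L ts → s′ ⊑ u′ →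
                   ∃[ s ] (Any (s ⊑_) ts × prune L s ≡ just s′)
  prune-⊑⁻-child L (u ∷ ts) u′∈ s′⊑u′ with prune L u in e
  prune-⊑⁻-child L (u ∷ ts) (here refl) s′⊑u′ | just _ with prune-⊑⁻ L u e s′⊑u′
  ... | s , s⊑u , es = s , here s⊑u , es
  prune-⊑⁻-child L (u ∷ ts) (there u′∈) s′⊑u′ | just _  = map₂ (map₁ there) (prune-⊑⁻-child L ts u′∈ s′⊑u′)
  prune-⊑⁻-child L (u ∷ ts) u′∈         s′⊑u′ | nothing = map₂ (map₁ there) (prune-⊑⁻-child L ts u′∈ s′⊑u′)

contract-leaves : ∀ {A B} → ContractStep A B → leaves A ≡ leaves B
contract-leaves (here xs us ys) = begin
  leavesF (xs ++ node us ∷ ys)              ≡⟨ leavesF-++ xs (node us ∷ ys) ⟩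
  leavesF xs ++ leavesF us ++ leavesF ys    ≡⟨ cong (leavesF xs ++_) (leavesF-++ us ys) ⟨
  leavesF xs ++ leavesF (us ++ ys)          ≡⟨ leavesF-++ xs (us ++ ys) ⟨
  leavesF (xs ++ us ++ ys)                  ∎
  where open ≡-Reasoning
contract-leaves (inside xs {t} {t′} ys step) = begin
  leavesF (xs ++ t ∷ ys)                    ≡⟨ leavesF-++ xs (t ∷ ys) ⟩
  leavesF xs ++ leaves t ++ leavesF ys      ≡⟨ cong (λ l → leavesF xs ++ l ++ leavesF ys) (contract-leaves step) ⟩
  leavesF xs ++ leaves t′ ++ leavesF ys     ≡⟨ leavesF-++ xs (t′ ∷ ys) ⟨
  leavesF (xs ++ t′ ∷ ys)                   ∎
  where open ≡-Reasoning

contract-⊑⁻ : ∀ {A B s} → ContractStep A B → s ⊑ B → ∃[ s₀ ] (s₀ ⊑ A × leaves s₀ ≡ leaves s)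
contract-⊑⁻ step ⊑-refl = _ , ⊑-refl , contract-leaves step
contract-⊑⁻ (here xs us ys) (⊑-child t∈ s⊑t) with ∈-++⁻ xs t∈
... | inj₁ t∈xs = _ , ⊑-child (∈-++⁺ˡ t∈xs) s⊑t , refl
... | inj₂ t∈us++ys with ∈-++⁻ us t∈us++ys
...   | inj₁ t∈us = _ , ⊑-child (∈-insert xs) (⊑-child t∈us s⊑t) , refl
...   | inj₂ t∈ys = _ , ⊑-child (∈-++⁺ʳ xs (there t∈ys)) s⊑t , refl
contract-⊑⁻ (inside xs ys step) (⊑-child t∈ s⊑t) with ∈-++⁻ xs t∈
... | inj₁ t∈xs        = _ , ⊑-child (∈-++⁺ˡ t∈xs) s⊑t , refl
... | inj₂ (there t∈ys) = _ , ⊑-child (∈-++⁺ʳ xs (there t∈ys)) s⊑t , refl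
... | inj₂ (here refl) with contract-⊑⁻ step s⊑t
...   | s₀ , s₀⊑ , e = s₀ , ⊑-child (∈-insert xs) s₀⊑ , e

contracts-⊑⁻ : ∀ {A B s} → Contracts A B → s ⊑ B → ∃[ s₀ ] (s₀ ⊑ A × leaves s₀ ≡ leaves s)
contracts-⊑⁻ ε s⊑B = _ , s⊑B , refl
contracts-⊑⁻ (step ◅ steps) s⊑B with contracts-⊑⁻ steps s⊑B
... | s₁ , s₁⊑ , e₁ with contract-⊑⁻ step s₁⊑
...   | s₀ , s₀⊑ , e₀ = s₀ , s₀⊑ , trans e₀ e₁

Separates : Tree → ℕ → ℕ → ℕ → Set
Separates T a b c = ∃[ s ] (s ⊑ T × a ∈ leaves s × b ∈ leaves s × c ∉ leaves s)

≅-triplet⇒separates : ∀ {T a b c} → T ≅ tripletTree (a , b , c) → c ≢ a → c ≢ b → Separates T a b c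
≅-triplet⇒separates {a = a} {b} {c}
  (node≅ {us = _ ∷ _ ∷ []} ts↭ (node≅ {ts₁} ts₁↭ (leaf≅ ∷ leaf≅ ∷ []) ∷ leaf≅ ∷ [])) c≢a c≢b =
  node ts₁ , ⊑-child (∈-resp-↭ (↭-sym ts↭) (here refl)) ⊑-refl ,
  ∈-leavesF⁺ (∈-resp-↭ (↭-sym ts₁↭) (here refl)) (here refl) ,
  ∈-leavesF⁺ (∈-resp-↭ (↭-sym ts₁↭) (there (here refl))) (here refl) , c∉
  where
  c∉ : c ∉ leavesF ts₁
  c∉ c∈ with ∈-leavesF⁻ ts₁ c∈
  ... | t , t∈ , c∈t with ∈-resp-↭ ts₁↭ t∈
  c∉ _ | .(leaf a) , _ , here refl | here refl         = c≢a refl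
  c∉ _ | .(leaf b) , _ , here refl | there (here refl) = c≢b refl

displays⇒separates : ∀ {T a b c} → Displays T (a , b , c) → c ≢ a → c ≢ b → Separates T a b c
displays⇒separates {T} {a} {b} {c} (_ , T′ , restr , T″ , contracts , T″≅) c≢a c≢b
  with ≅-triplet⇒separates T″≅ c≢a c≢b
... | s″ , s″⊑ , a∈s″ , b∈s″ , c∉s″ with contracts-⊑⁻ contracts s″⊑
...   | s′ , s′⊑ , leaves-s′ with prune-⊑⁻ (a ∷ b ∷ c ∷ []) T restr s′⊑
...     | s , s⊑ , es = s , s⊑ , lift a∈s″ , lift b∈s″ , c∉s
  where
  lift : ∀ {x} → x ∈ leaves s″ → x ∈ leaves s
  lift x∈ = proj₁ (∈-prune⁻ _ s es (subst (_ ∈_) (sym leaves-s′) x∈))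
  c∉s : c ∉ leaves s
  c∉s c∈ = c∉s″ (subst (_ ∈_) leaves-s′ (∈-prune⁺ _ s es c∈ (there (there (here refl)))))

two-children⇒¬single-label : ∀ {c t u} us → Branching t → Branching u → Unique (leavesF (t ∷ u ∷ us)) →
                        ¬ (∀ {y} → y ∈ leavesF (t ∷ u ∷ us) → y ≡ c)
two-children⇒¬single-label {t = t} _ bt bu uniq only-c with leaves-nonempty bt | leaves-nonempty bu
... | x , x∈t | y , y∈u =
  Unique-++⇒Disjoint (leaves t) uniq (x∈t , subst (_∈ _) y≡x (∈-++⁺ˡ y∈u))
  where
  y≡x = trans (only-c (∈-++⁺ʳ (leaves t) (∈-++⁺ˡ y∈u))) (sym (only-c (∈-++⁺ˡ x∈t)))

single-label⇒leaf : ∀ {c t} → Branching t → Unique (leaves t) → (∀ {y} → y ∈ leaves t → y ≡ c) →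
                    t ≡ leaf c
single-label⇒leaf leaf                           _    only-c = cong leaf (only-c (here refl))
single-label⇒leaf (node {us = us} (bt ∷ bu ∷ _)) uniq only-c =
  ⊥-elim (two-children⇒¬single-label us bt bu uniq only-c)

single-label-forest : ∀ {c ts} → All Branching ts → Unique (leavesF ts) → (∀ {y} → y ∈ leavesF ts → y ≡ c) →
                      ts ≡ [] ⊎ ts ≡ leaf c ∷ []
single-label-forest [] _ _ = inj₁ refl
single-label-forest {ts = t ∷ []} (bt ∷ []) uniq only-c =
  inj₂ (cong (_∷ []) (single-label⇒leaf bt (Unique-++⁻ˡ (leaves t) uniq) (λ y∈ → only-c (∈-++⁺ˡ y∈))))
single-label-forest {ts = _ ∷ _ ∷ us} (bt ∷ bu ∷ _) uniq only-c =
  ⊥-elim (two-children⇒¬single-label us bt bu uniq only-c)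

Unique-leavesF-split : ∀ xs w ys → Unique (leavesF (xs ++ w ∷ ys)) →
                Unique (leaves w) × Unique (leavesF (xs ++ ys)) × Disjoint (leaves w) (leavesF (xs ++ ys))
Unique-leavesF-split xs w ys uniq
  with Unique-++-middle⁻ (leavesF xs) (subst Unique (leavesF-++ xs (w ∷ ys)) uniq)
... | uniq-w , uniq-rest , w#rest =
  uniq-w , subst Unique (sym (leavesF-++ xs ys)) uniq-rest ,
  λ (y∈w , y∈rest) → w#rest (y∈w , subst (_ ∈_) (leavesF-++ xs ys) y∈rest)

leavesF-drop⊆ : ∀ xs w ys → leavesF (xs ++ ys) ⊆ leavesF (xs ++ w ∷ ys)
leavesF-drop⊆ xs w ys = leavesF-mono (++⁺ʳ xs (xs⊆x∷xs ys w))

leaves-insert⊆ : ∀ xs w ys → leaves w ⊆ leavesF (xs ++ w ∷ ys)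
leaves-insert⊆ xs w ys = ∈-leavesF⁺ (∈-insert xs)

siblings-nonempty : ∀ xs {w} ys → Branching (node (xs ++ w ∷ ys)) → ∃[ y ] y ∈ leavesF (xs ++ ys)
siblings-nonempty []       []       ()
siblings-nonempty []       (u ∷ ys) (node (_ ∷ bu ∷ _)) = map₂ ∈-++⁺ˡ (leaves-nonempty bu)
siblings-nonempty (x ∷ xs) ys       b with children-Branching b
... | bx ∷ _ = map₂ ∈-++⁺ˡ (leaves-nonempty bx)

single-label-siblings⇒≅ : ∀ {c w w′} xs ys → Branching (node (xs ++ w ∷ ys)) → Unique (leavesF (xs ++ w ∷ ys)) →
                          (∀ {y} → y ∈ leavesF (xs ++ ys) → y ≡ c) → w ≅ w′ →
                          node (xs ++ w ∷ ys) ≅ node (w′ ∷ leaf c ∷ [])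
single-label-siblings⇒≅ {c} {w} {w′} xs ys b uniq only-c w≅ = assemble xs ys b siblings≡
  where
  siblings≡ : xs ++ ys ≡ [] ⊎ xs ++ ys ≡ leaf c ∷ []
  siblings≡ = single-label-forest (All-resp-⊇ (++⁺ʳ xs (xs⊆x∷xs ys w)) (children-Branching b))
                                  (proj₁ (proj₂ (Unique-leavesF-split xs w ys uniq))) only-c
  assemble : ∀ xs ys → Branching (node (xs ++ w ∷ ys)) → xs ++ ys ≡ [] ⊎ xs ++ ys ≡ leaf c ∷ [] →
             node (xs ++ w ∷ ys) ≅ node (w′ ∷ leaf c ∷ [])
  assemble []          []      ()
  assemble []          (_ ∷ _) _ (inj₁ ())
  assemble []          _       _ (inj₂ refl) = node≅ ↭-refl (w≅ ∷ leaf≅ ∷ [])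
  assemble (_ ∷ _)     _       _ (inj₁ ())
  assemble (_ ∷ [])    []      _ (inj₂ refl) = node≅ (swap _ _ ↭-refl) (w≅ ∷ leaf≅ ∷ [])
  assemble (_ ∷ [])    (_ ∷ _) _ (inj₂ ())
  assemble (_ ∷ _ ∷ _) _       _ (inj₂ ())

cherry : ∀ {a b w} → a ≢ b → Branching w → Unique (leaves w) →
         (∀ {y} → y ∈ leaves w → y ≡ a ⊎ y ≡ b) → a ∈ leaves w → b ∈ leaves w →
         w ≅ node (leaf a ∷ leaf b ∷ [])
cherry a≢b leaf _ _ (here refl) (here refl) = ⊥-elim (a≢b refl)
cherry {a} {b} {node ts} a≢b bw uniq a-or-b a∈ b∈ with ∈-leavesF⁻ ts a∈
... | t , t∈ , a∈t with ∈-∃++ t∈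
...   | xs , ys , refl with Unique-leavesF-split xs t ys uniq
...     | uniq-t , _ , t#rest
  with single-label⇒leaf (All.lookup (children-Branching bw) (∈-insert xs)) uniq-t only-a
  where
  -- b ∈ t would leave no label for the (nonempty) other children
  only-a : ∀ {y} → y ∈ leaves t → y ≡ a
  only-a y∈t with a-or-b (leaves-insert⊆ xs t ys y∈t)
  ... | inj₁ y≡a = y≡a
  ... | inj₂ refl with siblings-nonempty xs ys bw
  ...   | z , z∈rest with a-or-b (leavesF-drop⊆ xs t ys z∈rest)
  ...     | inj₁ refl = contradiction (a∈t , z∈rest) t#rest
  ...     | inj₂ refl = contradiction (y∈t , z∈rest) t#rest
... | refl = single-label-siblings⇒≅ xs ys bw uniq only-b leaf≅
  where
  only-b : ∀ {y} → y ∈ leavesF (xs ++ ys) → y ≡ b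
  only-b y∈rest with a-or-b (leavesF-drop⊆ xs (leaf a) ys y∈rest)
  ... | inj₁ refl = contradiction (here refl , y∈rest) t#rest
  ... | inj₂ y≡b  = y≡b

restriction≅triplet : ∀ {a b c T s} → a ≢ b → Branching T → Unique (leaves T) →
                      leaves T ⊆ a ∷ b ∷ c ∷ [] → s ⊑ T → a ∈ leaves s → b ∈ leaves s → c ∉ leaves s →
                      c ∈ leaves T → T ≅ tripletTree (a , b , c)
restriction≅triplet _ _ _ _ ⊑-refl _ _ c∉s c∈T = contradiction c∈T c∉s
restriction≅triplet {a} {b} {c} a≢b bT uniq ⊆abc (⊑-child {t = w} w∈ s⊑w) a∈s b∈s _ _ with ∈-∃++ w∈
... | xs , ys , refl with Unique-leavesF-split xs w ys uniq
...   | uniq-w , _ , w#rest =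
  single-label-siblings⇒≅ xs ys bT uniq only-c
    (cherry a≢b (All.lookup (children-Branching bT) (∈-insert xs)) uniq-w only-ab a∈w b∈w)
  where
  a∈w = leaves-⊑ s⊑w a∈s
  b∈w = leaves-⊑ s⊑w b∈s
  only-c : ∀ {y} → y ∈ leavesF (xs ++ ys) → y ≡ c
  only-c y∈rest with ⊆abc (leavesF-drop⊆ xs w ys y∈rest)
  ... | here refl               = contradiction (a∈w , y∈rest) w#rest
  ... | there (here refl)       = contradiction (b∈w , y∈rest) w#rest
  ... | there (there (here y≡c)) = y≡c
  only-ab : ∀ {y} → y ∈ leaves w → y ≡ a ⊎ y ≡ b
  only-ab y∈w with ⊆abc (leaves-insert⊆ xs w ys y∈w)
  ... | here y≡a                 = inj₁ y≡a
  ... | there (here y≡b)         = inj₂ y≡b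
  ... | there (there (here refl)) with siblings-nonempty xs ys bT
  ...   | z , z∈rest = contradiction (y∈w , subst (_∈ _) (only-c z∈rest) z∈rest) w#rest

separates⇒displays : ∀ {T a b c} → a ≢ b → Unique (leaves T) → c ∈ leaves T →
                     Separates T a b c → Displays T (a , b , c)
separates⇒displays {T} {a} {b} {c} a≢b uniq c∈T (s , s⊑T , a∈s , b∈s , c∉s)
  with prune-defined (a ∷ b ∷ c ∷ []) s (here refl) a∈s
... | s′ , es with prune-⊑ (a ∷ b ∷ c ∷ []) s⊑T es
...   | T′ , eT , s′⊑T′ =
  abc⊆T , T′ , eT , T′ , ε ,
  restriction≅triplet a≢b (prune-Branching abc T eT) uniq′ (proj₂ ∘ ∈-prune⁻ abc T eT) s′⊑T′
    (∈-prune⁺ abc s es a∈s (here refl)) (∈-prune⁺ abc s es b∈s (there (here refl)))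
    (c∉s ∘ proj₁ ∘ ∈-prune⁻ abc s es) (∈-prune⁺ abc T eT c∈T (there (there (here refl))))
  where
  abc = a ∷ b ∷ c ∷ []
  abc⊆T : abc ⊆ leaves T
  abc⊆T (here refl)               = leaves-⊑ s⊑T a∈s
  abc⊆T (there (here refl))       = leaves-⊑ s⊑T b∈s
  abc⊆T (there (there (here refl))) = c∈T
  uniq′ : Unique (leaves T′)
  uniq′ = subst Unique (sym (prune≡just⇒leaves abc T eT)) (filter⁺ (_∈? abc) uniq)

∈-iterate-suc⁻ : ∀ {x} s k → x ∈ iterate suc s k → s ≤ x × x < s + k
∈-iterate-suc⁻ s (suc k) (here refl) = ≤-refl , m<m+n s z<s
∈-iterate-suc⁻ {x} s (suc k) (there x∈) with ∈-iterate-suc⁻ (suc s) k x∈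
... | s<x , x< = <⇒≤ s<x , subst (x <_) (sym (+-suc s k)) x<

∈-iterate-suc⁺ : ∀ {x} s k → s ≤ x → x < s + k → x ∈ iterate suc s k
∈-iterate-suc⁺ {x} s zero    s≤x x< = contradiction s≤x (<⇒≱ (subst (x <_) (+-identityʳ s) x<))
∈-iterate-suc⁺ {x} s (suc k) s≤x x< with s ≟ x
... | yes refl = here refl
... | no  s≢x  = there (∈-iterate-suc⁺ (suc s) k (≤∧≢⇒< s≤x s≢x) (subst (x <_) (+-suc s k) x<))

Unique-iterate-suc : ∀ s k → Unique (iterate suc s k)
Unique-iterate-suc s zero    = []
Unique-iterate-suc s (suc k) =
  All.tabulate (λ x∈ → <⇒≢ (proj₁ (∈-iterate-suc⁻ (suc s) k x∈))) ∷ Unique-iterate-suc (suc s) k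

iterate-suc-++ : ∀ s k l → iterate suc s k ++ iterate suc (s + k) l ≡ iterate suc s (k + l)
iterate-suc-++ s zero    l = cong (λ s′ → iterate suc s′ l) (+-identityʳ s)
iterate-suc-++ s (suc k) l =
  cong (s ∷_) (trans (cong (λ s′ → iterate suc (suc s) k ++ iterate suc s′ l) (+-suc s k))
                     (iterate-suc-++ (suc s) k l))

caterpillar : ℕ → ℕ → Tree
caterpillar s zero    = leaf s
caterpillar s (suc k) = node (leaf s ∷ caterpillar (suc s) k ∷ [])

leaves-caterpillar : ∀ s k → leaves (caterpillar s k) ≡ iterate suc s (suc k)
leaves-caterpillar s zero    = refl
leaves-caterpillar s (suc k) = cong (s ∷_) (trans (++-identityʳ _) (leaves-caterpillar (suc s) k))

caterpillar-NonRootOK : ∀ s k → NonRootOK (caterpillar s k)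
caterpillar-NonRootOK s zero    = leafOK
caterpillar-NonRootOK s (suc k) = nodeOK (s≤s (s≤s z≤n)) (leafOK ∷ caterpillar-NonRootOK (suc s) k ∷ [])

∈-caterpillar⁺ : ∀ {x} s k → s ≤ x → x ≤ s + k → x ∈ leaves (caterpillar s k)
∈-caterpillar⁺ {x} s k s≤x x≤ = subst (x ∈_) (sym (leaves-caterpillar s k))
  (∈-iterate-suc⁺ s (suc k) s≤x (subst (x <_) (sym (+-suc s k)) (s≤s x≤)))

∈-caterpillar⁻ : ∀ {x} s k → x ∈ leaves (caterpillar s k) → s ≤ x × x ≤ s + k
∈-caterpillar⁻ {x} s k x∈ with ∈-iterate-suc⁻ s (suc k) (subst (x ∈_) (leaves-caterpillar s k) x∈)
... | s≤x , x< = s≤x , ≤-pred (subst (x <_) (+-suc s k) x<)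

link : ℕ → Triplet
link x = x , suc x , 0

caterpillar⇒displays-link : ∀ {T s k x} → Phylo T → 0 ∈ leaves T → caterpillar s k ⊑ T →
                            0 < s → s ≤ x → x < s + k → Displays T (link x)
caterpillar⇒displays-link {s = s} {k} {x} phylo 0∈T cat⊑T 0<s s≤x x< =
  separates⇒displays (<⇒≢ (n<1+n x)) (Phylo.distinct phylo) 0∈T
    (caterpillar s k , cat⊑T ,
     ∈-caterpillar⁺ s k s≤x (<⇒≤ x<) , ∈-caterpillar⁺ s k (≤-trans s≤x (n≤1+n x)) x< ,
     λ 0∈ → <⇒≱ 0<s (proj₁ (∈-caterpillar⁻ s k 0∈)))

links : ℕ → List Triplet
links p = map link (iterate suc 1 (suc p))

chain : ℕ → List Triplet
chain p = (0 , 1 , 2 + p) ∷ links p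

∈-links⁺ : ∀ {p x} → 1 ≤ x → x ≤ suc p → link x ∈ links p
∈-links⁺ {p} 1≤x x≤ = ∈-map⁺ link (∈-iterate-suc⁺ 1 (suc p) 1≤x (s≤s x≤))

∈-links⁻ : ∀ {p t} → t ∈ links p → ∃[ j ] (j ≤ p × t ≡ link (suc j))
∈-links⁻ {p} t∈ with ∈-map⁻ link t∈
... | x , x∈ , refl with ∈-iterate-suc⁻ 1 (suc p) x∈
...   | s≤s {n = j} z≤n , s≤s j< = j , ≤-pred j< , refl

length-chain : ∀ p → length (chain p) ≡ 2 + p
length-chain p = cong suc (trans (length-map link (iterate suc 1 (suc p))) (length-iterate suc 1 (suc p)))

chain-TripletSet : ∀ p → TripletSet (chain p)
chain-TripletSet p =
  (z<s , (λ ()) , (λ ())) ∷ All.tabulate link-valid ,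
  All.tabulate root∉links ∷ Unique-map⁺ (cong proj₁) (Unique-iterate-suc 1 (suc p))
  where
  link-valid : ∀ {t} → t ∈ links p → IsTriplet t
  link-valid t∈ with ∈-links⁻ t∈
  ... | _ , _ , refl = n<1+n _ , (λ ()) , (λ ())
  root∉links : ∀ {t} → t ∈ links p → (0 , 1 , 2 + p) ≢ t
  root∉links t∈ with ∈-links⁻ t∈
  ... | _ , _ , refl = λ ()

chain-LabelCount : ∀ p → LabelCount (chain p) (3 + p)
chain-LabelCount p =
  iterate suc 0 (3 + p) , Unique-iterate-suc 0 (3 + p) , length-iterate suc 0 (3 + p) ,
  λ x → mk⇔ (labelled x ∘ proj₂ ∘ ∈-iterate-suc⁻ 0 (3 + p)) (∈-iterate-suc⁺ 0 (3 + p) z≤n ∘ bounded)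
  where
  labelled : ∀ x → x < 3 + p → InLabels x (chain p)
  labelled zero          _             = here (here refl)
  labelled (suc zero)    _             = here (there (here refl))
  labelled (suc (suc x)) (s≤s (s≤s x<)) = there (lose (∈-links⁺ (s≤s z≤n) x<) (there (here refl)))
  bounded : ∀ {x} → InLabels x (chain p) → x < 3 + p
  bounded x∈ with find x∈
  ... | _ , here refl , here refl                 = z<s
  ... | _ , here refl , there (here refl)         = s≤s z<s
  ... | _ , here refl , there (there (here refl)) = ≤-refl
  ... | _ , there t∈ , x∈t with ∈-links⁻ t∈
  ...   | j , j≤p , refl with x∈t
  ...     | here refl                 = s≤s (s≤s (m≤n⇒m≤1+n j≤p))
  ...     | there (here refl)         = s≤s (s≤s (s≤s j≤p))
  ...     | there (there (here refl)) = z<s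

chain-incompatible : ∀ p → ¬ Compatible (chain p)
chain-incompatible p (T , phylo , displays)
  with displays⇒separates {T} (All.lookup displays (here refl)) (λ ()) (λ ())
... | s , s⊑T , 0∈s , 1∈s , 2+p∉s = 2+p∉s (reach (suc p) ≤-refl)
  where
  reach : ∀ k → k ≤ suc p → suc k ∈ leaves s
  reach zero    _   = 1∈s
  reach (suc k) k<
    with displays⇒separates {T} (All.lookup displays (there (∈-links⁺ (s≤s z≤n) k<))) (λ ()) (λ ())
  ... | sₖ , sₖ⊑T , k+1∈sₖ , k+2∈sₖ , 0∉sₖ
    with clusters-nested (Phylo.distinct phylo) s⊑T sₖ⊑T (reach k (<⇒≤ k<)) k+1∈sₖ
  ...   | inj₁ s⊆sₖ = contradiction (s⊆sₖ 0∈s) 0∉sₖ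
  ...   | inj₂ sₖ⊆s = sₖ⊆s k+2∈sₖ

tree-omitting-root : ℕ → Tree
tree-omitting-root p = node (leaf 0 ∷ caterpillar 1 (suc p) ∷ [])

tree-omitting-root-Phylo : ∀ p → Phylo (tree-omitting-root p)
tree-omitting-root-Phylo p = record
  { shape    = rootNode z<s (leafOK ∷ caterpillar-NonRootOK 1 (suc p) ∷ [])
  ; distinct = subst Unique (cong (0 ∷_) (sym (trans (++-identityʳ _) (leaves-caterpillar 1 (suc p)))))
                            (Unique-iterate-suc 0 (3 + p))
  }

tree-omitting-root-displays : ∀ p {t} → t ∈ chain p → t ≢ (0 , 1 , 2 + p) →
                              Displays (tree-omitting-root p) t
tree-omitting-root-displays p (here refl) t≢root = contradiction refl t≢root
tree-omitting-root-displays p (there t∈) _ with ∈-links⁻ t∈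
... | j , j≤p , refl =
  caterpillar⇒displays-link (tree-omitting-root-Phylo p) (here refl) (⊑-child (there (here refl)) ⊑-refl)
    z<s (s≤s z≤n) (s≤s (s≤s j≤p))

tree-omitting-link : ℕ → ℕ → Tree
tree-omitting-link j q = node (node (leaf 0 ∷ caterpillar 1 j ∷ []) ∷ caterpillar (2 + j) q ∷ [])

tree-omitting-link-Phylo : ∀ j q → Phylo (tree-omitting-link j q)
tree-omitting-link-Phylo j q = record
  { shape    = rootNode z<s (nodeOK (s≤s (s≤s z≤n)) (leafOK ∷ caterpillar-NonRootOK 1 j ∷ []) ∷
                             caterpillar-NonRootOK (2 + j) q ∷ [])
  ; distinct = subst Unique (sym leaves≡) (Unique-iterate-suc 0 (2 + j + suc q))
  }
  where
  leaves≡ : leaves (tree-omitting-link j q) ≡ iterate suc 0 (2 + j + suc q)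
  leaves≡ = begin
    (0 ∷ leaves (caterpillar 1 j) ++ []) ++ leaves (caterpillar (2 + j) q) ++ []
      ≡⟨ cong₂ (λ l r → (0 ∷ l) ++ r) (++-identityʳ (leaves (caterpillar 1 j)))
                                       (++-identityʳ (leaves (caterpillar (2 + j) q))) ⟩
    (0 ∷ leaves (caterpillar 1 j)) ++ leaves (caterpillar (2 + j) q)
      ≡⟨ cong₂ (λ l r → (0 ∷ l) ++ r) (leaves-caterpillar 1 j) (leaves-caterpillar (2 + j) q) ⟩
    iterate suc 0 (2 + j) ++ iterate suc (2 + j) (suc q)
      ≡⟨ iterate-suc-++ 0 (2 + j) (suc q) ⟩
    iterate suc 0 (2 + j + suc q) ∎
    where open ≡-Reasoning

tree-omitting-link-displays : ∀ j q {t} → t ∈ chain (j + q) → t ≢ link (suc j) →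
                              Displays (tree-omitting-link j q) t
tree-omitting-link-displays j q (here refl) _ =
  separates⇒displays (λ ()) (Phylo.distinct (tree-omitting-link-Phylo j q)) 2+j+q∈
    (node (leaf 0 ∷ caterpillar 1 j ∷ []) , ⊑-child (here refl) ⊑-refl ,
     here refl , there (∈-++⁺ˡ (∈-caterpillar⁺ 1 j ≤-refl (s≤s z≤n))) , 2+j+q∉)
  where
  2+j+q∈ : 2 + j + q ∈ leaves (tree-omitting-link j q)
  2+j+q∈ = ∈-++⁺ʳ (0 ∷ leaves (caterpillar 1 j) ++ [])
                   (∈-++⁺ˡ (∈-caterpillar⁺ (2 + j) q (m≤m+n (2 + j) q) ≤-refl))
  2+j+q∉ : 2 + j + q ∉ leaves (node (leaf 0 ∷ caterpillar 1 j ∷ []))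
  2+j+q∉ (there x∈) with ∈-++⁻ (leaves (caterpillar 1 j)) x∈
  ... | inj₁ x∈cat = <⇒≱ (s≤s (s≤s (m≤m+n j q))) (proj₂ (∈-caterpillar⁻ 1 j x∈cat))
tree-omitting-link-displays j q (there t∈) t≢ with ∈-links⁻ t∈
... | x , x≤ , refl with <-cmp x j
...   | tri< x<j _ _ =
  caterpillar⇒displays-link (tree-omitting-link-Phylo j q) (here refl)
    (⊑-child (here refl) (⊑-child (there (here refl)) ⊑-refl)) z<s (s≤s z≤n) (s≤s x<j)
...   | tri≈ _ refl _ = contradiction refl t≢
...   | tri> _ _ j<x =
  caterpillar⇒displays-link (tree-omitting-link-Phylo j q) (here refl)
    (⊑-child (there (here refl)) ⊑-refl) z<s (s≤s j<x) (s≤s (s≤s x≤))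

All-except : ∀ {A : Set} {P : A → Set} {R S t} → (∀ {u} → u ∈ R → u ≢ t → P u) → S ⊆ R → t ∉ S →
             All P S
All-except P-except S⊆R t∉S = All.tabulate (λ u∈S → P-except (S⊆R u∈S) (λ { refl → t∉S u∈S }))

compatible-omitting : ∀ p {t} → t ∈ chain p → ∀ S → S ⊆ chain p → t ∉ S → Compatible S
compatible-omitting p (here refl) S S⊆R t∉S =
  tree-omitting-root p , tree-omitting-root-Phylo p , All-except (tree-omitting-root-displays p) S⊆R t∉S
compatible-omitting p (there t∈) S S⊆R t∉S with ∈-links⁻ t∈
... | j , j≤p , refl with m≤n⇒∃[o]m+o≡n j≤p
...   | q , refl =
  tree-omitting-link j q , tree-omitting-link-Phylo j q , All-except (tree-omitting-link-displays j q) S⊆R t∉S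

chain-proper-subsets-compatible : ∀ p S → ProperSubset S (chain p) → Compatible S
chain-proper-subsets-compatible p S (S⊆R , R⊈S)
  with find (¬All⇒Any¬ (_∈ₜ? S) (chain p) (R⊈S ∘ All.lookup))
... | t , t∈R , t∉S = compatible-omitting p t∈R S S⊆R t∉S

corollary3 : (n : ℕ) → 3 ≤ n →
    ∃[ R ] (TripletSet R × LabelCount R n ×
            ¬ Compatible R ×
            (∀ S → ProperSubset S R → Compatible S) ×
            length R ≡ n ∸ 1)
corollary3 (suc (suc (suc p))) (s≤s (s≤s (s≤s z≤n))) =
  chain p , chain-TripletSet p , chain-LabelCount p , chain-incompatible p ,
  chain-proper-subsets-compatible p , length-chain p
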